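{- The $\mathbb{K}$-span $\mathfrak{TD}$ of the elements $\mathcal{M}_T$ (with $T=\mathcal{T}(w)$ for some nonempty word $w$) is closed under the $\#$ product.
   Context: Let $A=\{a_1<a_2<\cdots\}$ be an infinite totally ordered alphabet (identified with $\{1<2<\cdots\}$) and $\mathbb{K}$ a field; work with formal $\mathbb{K}$-linear combinations of nonempty words over $A$. The $\#$ product of words is $(ux)\#(yv)=uxv$ if the letters $x,y$ are equal and $0$ otherwise ($u,v$ words, $x,y$ letters), extended bilinearly. For a word $w$ with distinct letters $b_1<\dots<b_r$, $\mathrm{pack}(w)$ is the image of $w$ under $b_i\mapsto i$; $w$ is packed if $\mathrm{pack}(w)=w$; $\mathbf{M}_u=\sum_{\mathrm{pack}(w)=u}w$. With every word $w$ associate a plane tree $\mathcal{T}(w)$: $\mathcal{T}(\varepsilon)$ is a single leaf; otherwise, if $m=\max(w)$ occurs exactly $j-1$ times, write $w=v_1mv_2\cdots v_{j-1}mv_j$ and let $\mathcal{T}(w)$ be the tree whose root has the $j$ subtrees $\mathcal{T}(v_1),\dots,\mathcal{T}(v_j)$ in this order. For a plane tree $T$, $\mathcal{M}_T=\sum_{u\text{ packed},\ \mathcal{T}(u)=T}\mathbf{M}_u$. -}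

module Defs where

open import Level using (Level; _⊔_; suc)
open import Algebra.Bundles using (CommutativeRing)
open import Data.Nat as ℕ using (ℕ; zero; _<?_; _≤?_)
import Data.Nat.Properties as ℕP
open import Data.List as L using (List; []; _∷_; map; filter; length; deduplicate; concatMap; foldr)
import Data.List.Properties as LP
open import Data.List.NonEmpty as L⁺ using (List⁺; _∷_; _∷⁺_; toList)
open import Data.Product using (_×_; _,_; Σ; ∃; proj₁; proj₂)
open import Relation.Nullary using (¬_; Dec; yes; no)
open import Relation.Nullary.Decidable using (map′)
open import Relation.Binary.PropositionalEquality using (_≡_; refl; cong; cong₂)
open import Data.List.Relation.Unary.All using (All)
open import Data.Bool using (Bool; true; false; if_then_else_)

record Field (c ℓ : Level) : Set (Level.suc (c ⊔ ℓ)) where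
  field
    commutativeRing : CommutativeRing c ℓ
  open CommutativeRing commutativeRing public
  field
    0≉1     : ¬ (0# ≈ 1#)
    inverse : ∀ x → ¬ (x ≈ 0#) → Σ Carrier λ y → x * y ≈ 1#

-- Words.  The alphabet a₁ < a₂ < ⋯ is identified with ℕ = {0 < 1 < ⋯}
-- (a_i ↦ i ∸ 1).  Words are lists of letters; nonempty words are List⁺ ℕ.

Word : Set
Word = List ℕ

-- pack: letter x ↦ its rank among the distinct letters of w
-- (0-based: the smallest distinct letter b₁ ↦ 0, b_i ↦ i ∸ 1).
distinctLetters : Word → List ℕ
distinctLetters w = deduplicate ℕ._≟_ w

pack : Word → Word
pack w = map (λ x → length (filter (_<? x) (distinctLetters w))) w

IsPacked : Word → Set
IsPacked u = pack u ≡ u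

isPacked? : (u : Word) → Dec (IsPacked u)
isPacked? u = LP.≡-dec ℕ._≟_ (pack u) u

data Tree : Set where
  node : List Tree → Tree

leaf : Tree
leaf = node []

splitOn : ℕ → Word → List Word
splitOn m [] = [] ∷ []
splitOn m (x ∷ xs) with x ℕ.≟ m | splitOn m xs
... | yes _ | ps       = [] ∷ ps
... | no  _ | []       = (x ∷ []) ∷ []          -- (never happens)
... | no  _ | (p ∷ ps) = (x ∷ p) ∷ ps

maxLetter : Word → ℕ
maxLetter = foldr ℕ._⊔_ 0

-- fuel-driven version; fuel = length w suffices since each piece of
-- splitOn (max w) w is strictly shorter than a nonempty w.
𝒯-fuel : ℕ → Word → Tree
𝒯-fuel zero    w        = leaf
𝒯-fuel (ℕ.suc n) []     = leaf
𝒯-fuel (ℕ.suc n) (x ∷ xs) =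
  node (map (𝒯-fuel n) (splitOn (maxLetter (x ∷ xs)) (x ∷ xs)))

𝒯 : Word → Tree
𝒯 w = 𝒯-fuel (length w) w

mutual
  _≟ᵀ_ : (s t : Tree) → Dec (s ≡ t)
  node ss ≟ᵀ node ts = map′ (cong node) (λ { refl → refl }) (ss ≟ᵀˢ ts)

  _≟ᵀˢ_ : (ss ts : List Tree) → Dec (ss ≡ ts)
  [] ≟ᵀˢ [] = yes refl
  [] ≟ᵀˢ (_ ∷ _) = no λ ()
  (_ ∷ _) ≟ᵀˢ [] = no λ ()
  (s ∷ ss) ≟ᵀˢ (t ∷ ts) with s ≟ᵀ t | ss ≟ᵀˢ ts
  ... | yes refl | yes refl = yes refl
  ... | no ne    | _        = no λ { refl → ne refl }
  ... | _        | no ne    = no λ { refl → ne refl }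

wordsOf : ℕ → ℕ → List Word
wordsOf zero      k = [] ∷ []
wordsOf (ℕ.suc n) k = concatMap (λ x → map (x ∷_) (wordsOf n k)) (L.upTo k)

-- packed words of length n (all of them have letters < n)
packedWordsOfLength : ℕ → List Word
packedWordsOfLength n = filter isPacked? (wordsOf n n)

-- Formal (possibly infinite) K-linear combinations of nonempty words,
-- the # product, and the series 𝐌_u, ℳ_T.

module _ {c ℓ : Level} (K : Field c ℓ) where
  open Field K

  Series : Set c
  Series = List⁺ ℕ → Carrier

  _≋_ : Series → Series → Set ℓ
  f ≋ g = ∀ w → f w ≈ g w

  Σᴷ : List Carrier → Carrier
  Σᴷ = foldr _+_ 0#

  -- all pairs (p , s) of nonempty words with p # s = w (as words),
  -- i.e. p = x₁⋯xᵢ and s = xᵢ⋯xₙ for i = 1,…,n where w = x₁⋯xₙ.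
  splits : ℕ → List ℕ → List (List⁺ ℕ × List⁺ ℕ)
  splits x []       = ((x ∷ []) , (x ∷ [])) ∷ []
  splits x (y ∷ ys) = ((x ∷ []) , (x ∷ y ∷ ys))
                    ∷ map (λ ps → (x ∷⁺ proj₁ ps) , proj₂ ps) (splits y ys)

  -- bilinear extension of (ux)#(yv) = uxv if x = y, 0 otherwise:
  -- coefficient of w in f # g is Σ_{(p,s), p # s = w} f(p) g(s).
  _#_ : Series → Series → Series
  (f # g) (x ∷ xs) = Σᴷ (map (λ ps → f (proj₁ ps) * g (proj₂ ps)) (splits x xs))

  -- 𝐌_u = Σ_{pack(w) = u} w
  𝐌 : Word → Series
  𝐌 u w with LP.≡-dec ℕ._≟_ (pack (toList w)) u
  ... | yes _ = 1#
  ... | no  _ = 0#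

  -- ℳ_T = Σ_{u packed, 𝒯(u) = T} 𝐌_u.  Only packed u of length |w|
  -- contribute to the coefficient of w, so the coefficient is the finite
  -- sum over packed words u of length |w| with 𝒯(u) = T.
  ℳ : Tree → Series
  ℳ T w = Σᴷ (map (λ u → 𝐌 u w)
                  (filter (λ u → 𝒯 u ≟ᵀ T) (packedWordsOfLength (L⁺.length w))))

  IsWordTree : Tree → Set
  IsWordTree T = ∃ λ (w : List⁺ ℕ) → 𝒯 (toList w) ≡ T

  lincomb : List (Carrier × Tree) → Series
  lincomb cs w = Σᴷ (map (λ cT → proj₁ cT * ℳ (proj₂ cT) w) cs)

  InTD : Series → Set (c ⊔ ℓ)
  InTD f = ∃ λ (cs : List (Carrier × Tree)) → All (λ cT → IsWordTree (proj₂ cT)) cs × (f ≋ lincomb cs)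

-- Since 𝒯 is invariant under order-preserving relabelling of the letters, ℳ_T evaluated at a
-- word w is 1 if 𝒯(w) = T and 0 otherwise. So the coefficient of w = w₁⋯wₙ in ℳ_S # ℳ_T counts
-- the positions i with 𝒯(w₁⋯wᵢ) = S and 𝒯(wᵢ⋯wₙ) = T. Writing w = v₁ m v₂ ⋯ m vⱼ at its maximal
-- letter m, a prefix (or suffix) of w ends (or starts) inside one piece vₖ, so by induction the
-- trees of all prefixes and suffixes of w are determined by 𝒯(w). The coefficient is therefore a
-- function c(𝒯(w)), and it vanishes unless n = |S| + |T| − 1; hence ℳ_S # ℳ_T = Σ_R c(R) ℳ_R
-- with R ranging over the finitely many trees of packed words of that length. Bilinearity of #
-- extends this to the whole span.

module Submission where

open import Defs
open import Level using (Level)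
open import Data.Product using (_,_; proj₁; proj₂)
open import Function using (_∘_)

module Trees where

  open import Data.Nat as ℕ using (ℕ; zero; suc; _+_; _∸_; _≤_; _<_; z≤n; s≤s)
  open import Data.Nat.Properties
  open import Data.Nat.ListAction using (sum)
  open import Data.Bool using (true; false; if_then_else_)
  open import Data.Empty using (⊥-elim)
  open import Data.Product using (_×_; uncurry)
  open import Data.Sum using (inj₁; inj₂)
  open import Data.List using (List; []; _∷_; _++_; map; length; filter; take; drop; deduplicate; upTo)
  import Data.List.Properties as LP
  open import Data.List.Relation.Unary.All as All using (All; []; _∷_)
  open import Data.List.Relation.Unary.All.Properties using (++⁺; take⁺; drop⁺; map⁺; concat⁺; deduplicate⁺)
  open import Data.List.Relation.Unary.Any as Any using (here; there)
  open import Data.List.Membership.Propositional using (_∈_)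
  open import Data.List.Membership.Propositional.Properties
    using (∈-length; ∈-++⁺ʳ; ∈-map⁺; ∈-deduplicate⁺; ∈-concatMap⁺; ∈-upTo⁺)
  open import Function using (id)
  open import Relation.Binary.Definitions using (tri<; tri≈; tri>)
  open import Relation.Binary.PropositionalEquality
  open import Relation.Nullary using (yes; no; ¬?)
  open import Relation.Nullary.Reflects using (ofʸ; ofⁿ)
  open import Relation.Unary using (Pred; Decidable)

  join : ℕ → List Word → Word
  join m []            = []
  join m (p ∷ [])      = p
  join m (p ∷ q ∷ ps) = p ++ m ∷ join m (q ∷ ps)

  join-∷ : ∀ m x p ps → join m ((x ∷ p) ∷ ps) ≡ x ∷ join m (p ∷ ps)
  join-∷ m x p []      = refl
  join-∷ m x p (_ ∷ _) = refl

  length-join : ∀ m ps → length (join m ps) ≡ sum (map length ps) + (length ps ∸ 1)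
  length-join m []            = refl
  length-join m (p ∷ [])      = sym (trans (+-identityʳ _) (+-identityʳ (length p)))
  length-join m (p ∷ q ∷ ps) = begin
      length (p ++ m ∷ join m (q ∷ ps))
    ≡⟨ LP.length-++ p ⟩
      length p + suc (length (join m (q ∷ ps)))
    ≡⟨ cong (λ n → length p + suc n) (length-join m (q ∷ ps)) ⟩
      length p + suc (sum (map length (q ∷ ps)) + length ps)
    ≡⟨ cong (length p +_) (sym (+-suc _ (length ps))) ⟩
      length p + (sum (map length (q ∷ ps)) + suc (length ps))
    ≡⟨ sym (+-assoc (length p) _ _) ⟩
      length p + sum (map length (q ∷ ps)) + suc (length ps) ∎
    where open ≡-Reasoning

  splitOn-nonempty : ∀ m w → splitOn m w ≢ []
  splitOn-nonempty m [] ()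
  splitOn-nonempty m (x ∷ xs) with x ℕ.≟ m | splitOn m xs
  ... | yes _ | _      = λ ()
  ... | no _  | []     = λ ()
  ... | no _  | _ ∷ _ = λ ()

  join-splitOn : ∀ m w → join m (splitOn m w) ≡ w
  join-splitOn m [] = refl
  join-splitOn m (x ∷ xs)
    with x ℕ.≟ m | splitOn m xs | join-splitOn m xs | splitOn-nonempty m xs
  ... | yes refl | []     | _  | nonempty = ⊥-elim (nonempty refl)
  ... | yes refl | _ ∷ _ | ih | _        = cong (x ∷_) ih
  ... | no _     | []     | ih | _        = cong (x ∷_) ih
  ... | no _     | p ∷ ps | ih | _       = trans (join-∷ m x p ps) (cong (x ∷_) ih)

  All-splitOn : ∀ {p} {P : ℕ → Set p} m {w} → All P w → All (All P) (splitOn m w)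
  All-splitOn m []                 = [] ∷ []
  All-splitOn m {x ∷ xs} (px ∷ pxs) with x ℕ.≟ m | splitOn m xs | All-splitOn m pxs
  ... | yes _ | _      | ih       = [] ∷ ih
  ... | no _  | []     | _        = (px ∷ []) ∷ []
  ... | no _  | _ ∷ _ | ap ∷ aps = (px ∷ ap) ∷ aps

  splitOn-pieces-≢ : ∀ m w → All (All (_≢ m)) (splitOn m w)
  splitOn-pieces-≢ m [] = [] ∷ []
  splitOn-pieces-≢ m (x ∷ xs) with x ℕ.≟ m | splitOn m xs | splitOn-pieces-≢ m xs
  ... | yes _   | _      | ih       = [] ∷ ih
  ... | no x≢m | []     | _        = (x≢m ∷ []) ∷ []
  ... | no x≢m | _ ∷ _ | ap ∷ aps = (x≢m ∷ ap) ∷ aps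

  splitOn-pieces-< : ∀ {m w} → All (_≤ m) w → All (All (_< m)) (splitOn m w)
  splitOn-pieces-< {m} {w} w≤m =
    All.map (All.zipWith (uncurry ≤∧≢⇒<)) (All.zip (All-splitOn m w≤m , splitOn-pieces-≢ m w))

  splitOn-length-≤ : ∀ m w → All (λ p → length p ≤ length w) (splitOn m w)
  splitOn-length-≤ m [] = z≤n ∷ []
  splitOn-length-≤ m (x ∷ xs) with x ℕ.≟ m | splitOn m xs | splitOn-length-≤ m xs
  ... | yes _ | _      | ih     = z≤n ∷ All.map m≤n⇒m≤1+n ih
  ... | no _  | []     | _      = s≤s z≤n ∷ []
  ... | no _  | _ ∷ _ | a ∷ as = s≤s a ∷ All.map m≤n⇒m≤1+n as

  splitOn-length-< : ∀ {m w} → m ∈ w → All (λ p → length p < length w) (splitOn m w)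
  splitOn-length-< {m} {x ∷ xs} m∈w with x ℕ.≟ m
  ... | yes _ = s≤s z≤n ∷ All.map s≤s (splitOn-length-≤ m xs)
  ... | no x≢m with m∈w
  ...   | here refl   = ⊥-elim (x≢m refl)
  ...   | there m∈xs with splitOn m xs | splitOn-length-< m∈xs
  ...     | []     | _      = s≤s (∈-length m∈xs) ∷ []
  ...     | _ ∷ _ | a ∷ as = s≤s a ∷ All.map m<n⇒m<1+n as

  splitOn-≢ : ∀ {m p} → All (_≢ m) p → splitOn m p ≡ p ∷ []
  splitOn-≢ {m} {[]}    []          = refl
  splitOn-≢ {m} {x ∷ p} (x≢m ∷ h) with x ℕ.≟ m | splitOn m p | splitOn-≢ h
  ... | yes x≡m | _ | _    = ⊥-elim (x≢m x≡m)
  ... | no _    | _ | refl = refl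

  splitOn-++-∷ : ∀ {m} p r → All (_≢ m) p → splitOn m (p ++ m ∷ r) ≡ p ∷ splitOn m r
  splitOn-++-∷ {m} [] r [] with m ℕ.≟ m
  ... | yes _   = refl
  ... | no m≢m = ⊥-elim (m≢m refl)
  splitOn-++-∷ {m} (x ∷ p) r (x≢m ∷ h) with x ℕ.≟ m | splitOn m (p ++ m ∷ r) | splitOn-++-∷ p r h
  ... | yes x≡m | _ | _    = ⊥-elim (x≢m x≡m)
  ... | no _    | _ | refl = refl

  splitOn-join : ∀ {m} q qs → All (All (_≢ m)) (q ∷ qs) → splitOn m (join m (q ∷ qs)) ≡ q ∷ qs
  splitOn-join q []         (h ∷ [])  = splitOn-≢ h
  splitOn-join q (q′ ∷ qs) (h ∷ hs) = trans (splitOn-++-∷ q _ h) (cong (q ∷_) (splitOn-join q′ qs hs))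

  maxLetter-∈ : ∀ x xs → maxLetter (x ∷ xs) ∈ x ∷ xs
  maxLetter-∈ x []       = here (⊔-identityʳ x)
  maxLetter-∈ x (y ∷ ys) with ≤-total x (maxLetter (y ∷ ys))
  ... | inj₁ x≤ = subst (_∈ x ∷ y ∷ ys) (sym (m≤n⇒m⊔n≡n x≤)) (there (maxLetter-∈ y ys))
  ... | inj₂ x≥ = here (m≥n⇒m⊔n≡m x≥)

  maxLetter-≥ : ∀ w → All (_≤ maxLetter w) w
  maxLetter-≥ []       = []
  maxLetter-≥ (x ∷ xs) = m≤m⊔n x _ ∷ All.map (λ y≤ → ≤-trans y≤ (m≤n⊔m x _)) (maxLetter-≥ xs)

  maxLetter-lub : ∀ {m w} → All (_≤ m) w → maxLetter w ≤ m
  maxLetter-lub []         = z≤n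
  maxLetter-lub (x≤ ∷ h) = ⊔-lub x≤ (maxLetter-lub h)

  maxLetter-unique : ∀ {m w} → m ∈ w → All (_≤ m) w → maxLetter w ≡ m
  maxLetter-unique {w = w} m∈w w≤m = ≤-antisym (maxLetter-lub w≤m) (All.lookup (maxLetter-≥ w) m∈w)

  𝒯-fuel-irrelevant : ∀ n n′ w → length w ≤ n → length w ≤ n′ → 𝒯-fuel n w ≡ 𝒯-fuel n′ w
  𝒯-fuel-irrelevant zero    zero     []       _          _            = refl
  𝒯-fuel-irrelevant zero    (suc n′) []       _          _            = refl
  𝒯-fuel-irrelevant (suc n) zero     []       _          _            = refl
  𝒯-fuel-irrelevant (suc n) (suc n′) []       _          _            = refl
  𝒯-fuel-irrelevant (suc n) (suc n′) (x ∷ xs) (s≤s |xs|≤n) (s≤s |xs|≤n′) =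
    cong node (LP.map-cong-local (All.map
      (λ { {p} (s≤s |p|≤) → 𝒯-fuel-irrelevant n n′ p (≤-trans |p|≤ |xs|≤n) (≤-trans |p|≤ |xs|≤n′) })
      (splitOn-length-< (maxLetter-∈ x xs))))

  𝒯-∷ : ∀ x xs → 𝒯 (x ∷ xs) ≡ node (map 𝒯 (splitOn (maxLetter (x ∷ xs)) (x ∷ xs)))
  𝒯-∷ x xs = cong node (LP.map-cong-local (All.map
    (λ { {p} (s≤s |p|≤) → 𝒯-fuel-irrelevant _ _ p |p|≤ ≤-refl })
    (splitOn-length-< (maxLetter-∈ x xs))))

  𝒯-splitOn-max : ∀ {m w} → m ∈ w → All (_≤ m) w → 𝒯 w ≡ node (map 𝒯 (splitOn m w))
  𝒯-splitOn-max {m} {x ∷ xs} m∈w w≤m =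
    trans (𝒯-∷ x xs) (cong (λ k → node (map 𝒯 (splitOn k (x ∷ xs)))) (maxLetter-unique m∈w w≤m))

  𝒯-induction : ∀ {p} (P : Word → Set p) → P [] →
                (∀ x xs → All P (splitOn (maxLetter (x ∷ xs)) (x ∷ xs)) → P (x ∷ xs)) →
                ∀ w → P w
  𝒯-induction P P[] step w = go (length w) w ≤-refl
    where
    go : ∀ n w → length w ≤ n → P w
    go _       []       _ = P[]
    go (suc n) (x ∷ xs) (s≤s |xs|≤n) = step x xs (All.map
      (λ { {p} (s≤s |p|≤) → go n p (≤-trans |p|≤ |xs|≤n) })
      (splitOn-length-< (maxLetter-∈ x xs)))

  -- The tree of v₁ m v₂ ⋯ m vⱼ built from the trees of the vₖ (see 𝒯-join); for j = 1 no m
  -- occurs and the tree is 𝒯(v₁) itself.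
  joinTree : List Tree → Tree
  joinTree (t ∷ [])  = t
  joinTree ts        = node ts

  𝒯-join : ∀ m ps → All (All (_< m)) ps → 𝒯 (join m ps) ≡ joinTree (map 𝒯 ps)
  𝒯-join m []            _  = refl
  𝒯-join m (q ∷ [])      _  = refl
  𝒯-join m (q ∷ q′ ∷ qs) ps<m =
    trans (𝒯-splitOn-max (∈-++⁺ʳ q (here refl)) (join-below (q ∷ q′ ∷ qs) (All.map (All.map <⇒≤) ps<m)))
          (cong (node ∘ map 𝒯) (splitOn-join q (q′ ∷ qs) (All.map (All.map <⇒≢) ps<m)))
    where
    join-below : ∀ ps → All (All (_≤ m)) ps → All (_≤ m) (join m ps)
    join-below []             []           = []
    join-below (p ∷ [])       (h ∷ [])     = h
    join-below (p ∷ p′ ∷ ps) (h ∷ hs) = ++⁺ h (≤-refl ∷ join-below (p′ ∷ ps) hs)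

  mutual
    size : Tree → ℕ
    size (node ts) = sizes ts + (length ts ∸ 1)

    sizes : List Tree → ℕ
    sizes []       = 0
    sizes (t ∷ ts) = size t + sizes ts

  size-𝒯 : ∀ w → size (𝒯 w) ≡ length w
  size-𝒯 = 𝒯-induction (λ w → size (𝒯 w) ≡ length w) refl step
    where
    sizes-map : ∀ ps → All (λ p → size (𝒯 p) ≡ length p) ps → sizes (map 𝒯 ps) ≡ sum (map length ps)
    sizes-map []       []       = refl
    sizes-map (p ∷ ps) (e ∷ es) = cong₂ _+_ e (sizes-map ps es)

    step : ∀ x xs → All (λ p → size (𝒯 p) ≡ length p) (splitOn (maxLetter (x ∷ xs)) (x ∷ xs)) →
           size (𝒯 (x ∷ xs)) ≡ length (x ∷ xs)
    step x xs ih = begin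
        size (𝒯 (x ∷ xs))
      ≡⟨ cong size (𝒯-∷ x xs) ⟩
        sizes (map 𝒯 ps) + (length (map 𝒯 ps) ∸ 1)
      ≡⟨ cong₂ _+_ (sizes-map ps ih) (cong (_∸ 1) (LP.length-map 𝒯 ps)) ⟩
        sum (map length ps) + (length ps ∸ 1)
      ≡⟨ sym (length-join m ps) ⟩
        length (join m ps)
      ≡⟨ cong length (join-splitOn m (x ∷ xs)) ⟩
        length (x ∷ xs) ∎
      where
      open ≡-Reasoning
      m  = maxLetter (x ∷ xs)
      ps = splitOn m (x ∷ xs)

  take-++-≤ : ∀ {k} (p r : Word) → k ≤ length p → take k (p ++ r) ≡ take k p
  take-++-≤ {zero}  p       r _         = refl
  take-++-≤ {suc k} (x ∷ p) r (s≤s k≤) = cong (x ∷_) (take-++-≤ p r k≤)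

  take-++-∷ : ∀ {k} (p : Word) m r → length p < k → take k (p ++ m ∷ r) ≡ p ++ m ∷ take (k ∸ suc (length p)) r
  take-++-∷ {suc k} []      m r _         = refl
  take-++-∷ {suc k} (x ∷ p) m r (s≤s p<) = cong (x ∷_) (take-++-∷ p m r p<)

  drop-++-≤ : ∀ {k} (p r : Word) → k ≤ length p → drop k (p ++ r) ≡ drop k p ++ r
  drop-++-≤ {zero}  p       r _         = refl
  drop-++-≤ {suc k} (x ∷ p) r (s≤s k≤) = drop-++-≤ p r k≤

  drop-++-∷ : ∀ {k} (p : Word) m r → length p < k → drop k (p ++ m ∷ r) ≡ drop (k ∸ suc (length p)) r
  drop-++-∷ {suc k} []      m r _         = refl
  drop-++-∷ {suc k} (x ∷ p) m r (s≤s p<) = drop-++-∷ p m r p<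

  mutual
    prefixTree : ℕ → Tree → Tree
    prefixTree k (node ts) = joinTree (prefixForest k ts)

    prefixForest : ℕ → List Tree → List Tree
    prefixForest k []            = []
    prefixForest k (t ∷ [])      = prefixTree k t ∷ []
    prefixForest k (t ∷ ts@(_ ∷ _)) =
      if k ℕ.≤ᵇ size t then prefixTree k t ∷ [] else t ∷ prefixForest (k ∸ suc (size t)) ts

  prefixPieces : ℕ → List Word → List Word
  prefixPieces k []            = []
  prefixPieces k (p ∷ [])      = take k p ∷ []
  prefixPieces k (p ∷ ps@(_ ∷ _)) =
    if k ℕ.≤ᵇ length p then take k p ∷ [] else p ∷ prefixPieces (k ∸ suc (length p)) ps

  prefixPieces-nonempty : ∀ k p ps → prefixPieces k (p ∷ ps) ≢ []
  prefixPieces-nonempty k p []       ()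
  prefixPieces-nonempty k p (q ∷ qs) with k ℕ.≤ᵇ length p
  ... | true  = λ ()
  ... | false = λ ()

  take-join : ∀ m k ps → take k (join m ps) ≡ join m (prefixPieces k ps)
  take-join m k []       = LP.take-[] k
  take-join m k (p ∷ ps) = go k p ps
    where
    go : ∀ k p ps → take k (join m (p ∷ ps)) ≡ join m (prefixPieces k (p ∷ ps))
    go k p []       = refl
    go k p (q ∷ qs) with k ℕ.≤ᵇ length p | ≤ᵇ-reflects-≤ k (length p)
    ... | true  | ofʸ k≤ = take-++-≤ p _ k≤
    ... | false | ofⁿ k≰
      with prefixPieces (k ∸ suc (length p)) (q ∷ qs) | prefixPieces-nonempty (k ∸ suc (length p)) q qs
         | go (k ∸ suc (length p)) q qs
    ...   | []     | nonempty | _  = ⊥-elim (nonempty refl)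
    ...   | _ ∷ _ | _        | ih = trans (take-++-∷ p m _ (≰⇒> k≰)) (cong (λ v → p ++ m ∷ v) ih)

  All-prefixPieces : ∀ {P : ℕ → Set} k {ps} → All (All P) ps → All (All P) (prefixPieces k ps)
  All-prefixPieces k []                  = []
  All-prefixPieces k (h ∷ [])            = take⁺ k h ∷ []
  All-prefixPieces k {p ∷ _ ∷ _} (h ∷ hs) with k ℕ.≤ᵇ length p
  ... | true  = take⁺ k h ∷ []
  ... | false = h ∷ All-prefixPieces _ hs

  PrefixTree : Word → Set
  PrefixTree w = ∀ k → 𝒯 (take k w) ≡ prefixTree k (𝒯 w)

  map-𝒯-prefixPieces : ∀ k {ps} → All PrefixTree ps → map 𝒯 (prefixPieces k ps) ≡ prefixForest k (map 𝒯 ps)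
  map-𝒯-prefixPieces k []         = refl
  map-𝒯-prefixPieces k (h ∷ [])   = cong (_∷ []) (h k)
  map-𝒯-prefixPieces k {p ∷ _ ∷ _} (h ∷ hs)
    with size (𝒯 p) | size-𝒯 p
  ... | _ | refl with k ℕ.≤ᵇ length p
  ...   | true  = cong (_∷ []) (h k)
  ...   | false = cong (𝒯 p ∷_) (map-𝒯-prefixPieces _ hs)

  𝒯-take : ∀ w → PrefixTree w
  𝒯-take = 𝒯-induction PrefixTree (λ k → cong 𝒯 (LP.take-[] k)) step
    where
    step : ∀ x xs → All PrefixTree (splitOn (maxLetter (x ∷ xs)) (x ∷ xs)) → PrefixTree (x ∷ xs)
    step x xs ih k = begin
        𝒯 (take k (x ∷ xs))
      ≡⟨ cong (𝒯 ∘ take k) (sym (join-splitOn m (x ∷ xs))) ⟩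
        𝒯 (take k (join m ps))
      ≡⟨ cong 𝒯 (take-join m k ps) ⟩
        𝒯 (join m (prefixPieces k ps))
      ≡⟨ 𝒯-join m _ (All-prefixPieces k (splitOn-pieces-< (maxLetter-≥ (x ∷ xs)))) ⟩
        joinTree (map 𝒯 (prefixPieces k ps))
      ≡⟨ cong joinTree (map-𝒯-prefixPieces k ih) ⟩
        prefixTree k (node (map 𝒯 ps))
      ≡⟨ cong (prefixTree k) (sym (𝒯-∷ x xs)) ⟩
        prefixTree k (𝒯 (x ∷ xs)) ∎
      where
      open ≡-Reasoning
      m  = maxLetter (x ∷ xs)
      ps = splitOn m (x ∷ xs)

  mutual
    suffixTree : ℕ → Tree → Tree
    suffixTree k (node ts) = joinTree (suffixForest k ts)

    suffixForest : ℕ → List Tree → List Tree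
    suffixForest k []               = []
    suffixForest k (t ∷ [])         = suffixTree k t ∷ []
    suffixForest k (t ∷ ts@(_ ∷ _)) =
      if k ℕ.≤ᵇ size t then suffixTree k t ∷ ts else suffixForest (k ∸ suc (size t)) ts

  suffixPieces : ℕ → List Word → List Word
  suffixPieces k []               = []
  suffixPieces k (p ∷ [])         = drop k p ∷ []
  suffixPieces k (p ∷ ps@(_ ∷ _)) =
    if k ℕ.≤ᵇ length p then drop k p ∷ ps else suffixPieces (k ∸ suc (length p)) ps

  drop-join : ∀ m k ps → drop k (join m ps) ≡ join m (suffixPieces k ps)
  drop-join m k []       = LP.drop-[] k
  drop-join m k (p ∷ ps) = go k p ps
    where
    go : ∀ k p ps → drop k (join m (p ∷ ps)) ≡ join m (suffixPieces k (p ∷ ps))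
    go k p []       = refl
    go k p (q ∷ qs) with k ℕ.≤ᵇ length p | ≤ᵇ-reflects-≤ k (length p)
    ... | true  | ofʸ k≤ = drop-++-≤ p _ k≤
    ... | false | ofⁿ k≰ = trans (drop-++-∷ p m _ (≰⇒> k≰)) (go _ q qs)

  All-suffixPieces : ∀ {P : ℕ → Set} k {ps} → All (All P) ps → All (All P) (suffixPieces k ps)
  All-suffixPieces k []                  = []
  All-suffixPieces k (h ∷ [])            = drop⁺ k h ∷ []
  All-suffixPieces k {p ∷ _ ∷ _} (h ∷ hs) with k ℕ.≤ᵇ length p
  ... | true  = drop⁺ k h ∷ hs
  ... | false = All-suffixPieces _ hs

  SuffixTree : Word → Set
  SuffixTree w = ∀ k → 𝒯 (drop k w) ≡ suffixTree k (𝒯 w)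

  map-𝒯-suffixPieces : ∀ k {ps} → All SuffixTree ps → map 𝒯 (suffixPieces k ps) ≡ suffixForest k (map 𝒯 ps)
  map-𝒯-suffixPieces k []         = refl
  map-𝒯-suffixPieces k (h ∷ [])   = cong (_∷ []) (h k)
  map-𝒯-suffixPieces k {p ∷ _ ∷ _} (h ∷ hs)
    with size (𝒯 p) | size-𝒯 p
  ... | _ | refl with k ℕ.≤ᵇ length p
  ...   | true  = cong (_∷ _) (h k)
  ...   | false = map-𝒯-suffixPieces _ hs

  𝒯-drop : ∀ w → SuffixTree w
  𝒯-drop = 𝒯-induction SuffixTree (λ k → cong 𝒯 (LP.drop-[] k)) step
    where
    step : ∀ x xs → All SuffixTree (splitOn (maxLetter (x ∷ xs)) (x ∷ xs)) → SuffixTree (x ∷ xs)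
    step x xs ih k = begin
        𝒯 (drop k (x ∷ xs))
      ≡⟨ cong (𝒯 ∘ drop k) (sym (join-splitOn m (x ∷ xs))) ⟩
        𝒯 (drop k (join m ps))
      ≡⟨ cong 𝒯 (drop-join m k ps) ⟩
        𝒯 (join m (suffixPieces k ps))
      ≡⟨ 𝒯-join m _ (All-suffixPieces k (splitOn-pieces-< (maxLetter-≥ (x ∷ xs)))) ⟩
        joinTree (map 𝒯 (suffixPieces k ps))
      ≡⟨ cong joinTree (map-𝒯-suffixPieces k ih) ⟩
        suffixTree k (node (map 𝒯 ps))
      ≡⟨ cong (suffixTree k) (sym (𝒯-∷ x xs)) ⟩
        suffixTree k (𝒯 (x ∷ xs)) ∎
      where
      open ≡-Reasoning
      m  = maxLetter (x ∷ xs)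
      ps = splitOn m (x ∷ xs)

  filter-map-local : ∀ {a b p q} {A : Set a} {B : Set b} {P : Pred B p} {Q : Pred A q}
                     (P? : Decidable P) (Q? : Decidable Q) (f : A → B) {l} →
                     All (λ z → (P (f z) → Q z) × (Q z → P (f z))) l →
                     filter P? (map f l) ≡ map f (filter Q? l)
  filter-map-local P? Q? f []                         = refl
  filter-map-local P? Q? f {z ∷ _} ((to , from) ∷ h) with P? (f z) | Q? z
  ... | yes _  | yes _  = cong (f z ∷_) (filter-map-local P? Q? f h)
  ... | yes pz | no ¬qz = ⊥-elim (¬qz (to pz))
  ... | no ¬pz | yes qz = ⊥-elim (¬pz (from qz))
  ... | no _   | no _   = filter-map-local P? Q? f h

  count< : ℕ → List ℕ → ℕ
  count< x D = length (filter (_<? x) D)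

  count<-mono-≤ : ∀ {x y} D → x ≤ y → count< x D ≤ count< y D
  count<-mono-≤ [] _ = z≤n
  count<-mono-≤ {x} {y} (z ∷ D) x≤y with z <? x | z <? y
  ... | yes z<x | yes z<y
    rewrite LP.filter-accept (_<? x) {xs = D} z<x | LP.filter-accept (_<? y) {xs = D} z<y =
    s≤s (count<-mono-≤ D x≤y)
  ... | yes z<x | no z≮y = ⊥-elim (z≮y (<-≤-trans z<x x≤y))
  ... | no z≮x  | yes z<y
    rewrite LP.filter-reject (_<? x) {xs = D} z≮x | LP.filter-accept (_<? y) {xs = D} z<y =
    m≤n⇒m≤1+n (count<-mono-≤ D x≤y)
  ... | no z≮x  | no z≮y
    rewrite LP.filter-reject (_<? x) {xs = D} z≮x | LP.filter-reject (_<? y) {xs = D} z≮y =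
    count<-mono-≤ D x≤y

  count<-mono : ∀ {x y D} → x ∈ D → x < y → count< x D < count< y D
  count<-mono {x} {y} {x ∷ D} (here refl) x<y
    rewrite LP.filter-reject (_<? x) {xs = D} (<-irrefl refl) | LP.filter-accept (_<? y) {xs = D} x<y =
    s≤s (count<-mono-≤ D (<⇒≤ x<y))
  count<-mono {x} {y} {z ∷ D} (there x∈D) x<y with z <? x | z <? y
  ... | yes z<x | yes z<y
    rewrite LP.filter-accept (_<? x) {xs = D} z<x | LP.filter-accept (_<? y) {xs = D} z<y =
    s≤s (count<-mono x∈D x<y)
  ... | yes z<x | no z≮y = ⊥-elim (z≮y (<-trans z<x x<y))
  ... | no z≮x  | yes z<y
    rewrite LP.filter-reject (_<? x) {xs = D} z≮x | LP.filter-accept (_<? y) {xs = D} z<y =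
    m<n⇒m<1+n (count<-mono x∈D x<y)
  ... | no z≮x  | no z≮y
    rewrite LP.filter-reject (_<? x) {xs = D} z≮x | LP.filter-reject (_<? y) {xs = D} z≮y =
    count<-mono x∈D x<y

  rank : Word → ℕ → ℕ
  rank w x = count< x (distinctLetters w)

  rank-mono : ∀ w {x y} → x ∈ w → y ∈ w → x < y → rank w x < rank w y
  rank-mono w x∈w _ = count<-mono (∈-deduplicate⁺ ℕ._≟_ x∈w)

  rank-< : ∀ w {x} → x ∈ w → rank w x < length w
  rank-< w {x} x∈w =
    <-≤-trans (LP.filter-notAll (_<? x) (distinctLetters w)
                (Any.map (λ { refl → <-irrefl refl }) (∈-deduplicate⁺ ℕ._≟_ x∈w)))
              (LP.length-deduplicate ℕ._≟_ w)

  module Relabel (L : Word) (φ : ℕ → ℕ) (φ-mono : ∀ {x y} → x ∈ L → y ∈ L → x < y → φ x < φ y) where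

    φ-mono-≤ : ∀ {x y} → x ∈ L → y ∈ L → x ≤ y → φ x ≤ φ y
    φ-mono-≤ x∈L y∈L x≤y with m≤n⇒m<n∨m≡n x≤y
    ... | inj₁ x<y  = <⇒≤ (φ-mono x∈L y∈L x<y)
    ... | inj₂ refl = ≤-refl

    φ-injective : ∀ {x y} → x ∈ L → y ∈ L → φ x ≡ φ y → x ≡ y
    φ-injective {x} {y} x∈L y∈L φx≡φy with <-cmp x y
    ... | tri< x<y _ _ = ⊥-elim (<⇒≢ (φ-mono x∈L y∈L x<y) φx≡φy)
    ... | tri≈ _ x≡y _ = x≡y
    ... | tri> _ _ y<x = ⊥-elim (<⇒≢ (φ-mono y∈L x∈L y<x) (sym φx≡φy))

    splitOn-map : ∀ {m} → m ∈ L → ∀ {w} → All (_∈ L) w → splitOn (φ m) (map φ w) ≡ map (map φ) (splitOn m w)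
    splitOn-map m∈L []                 = refl
    splitOn-map {m} m∈L {x ∷ xs} (x∈L ∷ h)
      with x ℕ.≟ m | φ x ℕ.≟ φ m | splitOn m xs | splitOn (φ m) (map φ xs) | splitOn-map m∈L h
    ... | yes _   | yes _     | _      | _ | refl = refl
    ... | yes x≡m | no φx≢φm | _      | _ | _    = ⊥-elim (φx≢φm (cong φ x≡m))
    ... | no x≢m  | yes φx≡φm | _      | _ | _    = ⊥-elim (x≢m (φ-injective x∈L m∈L φx≡φm))
    ... | no _    | no _      | []     | _ | refl = refl
    ... | no _    | no _      | _ ∷ _ | _ | refl = refl

    𝒯-map : ∀ w → All (_∈ L) w → 𝒯 (map φ w) ≡ 𝒯 w
    𝒯-map = 𝒯-induction (λ w → All (_∈ L) w → 𝒯 (map φ w) ≡ 𝒯 w) (λ _ → refl) step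
      where
      step : ∀ x xs → All (λ w → All (_∈ L) w → 𝒯 (map φ w) ≡ 𝒯 w) (splitOn (maxLetter (x ∷ xs)) (x ∷ xs)) →
             All (_∈ L) (x ∷ xs) → 𝒯 (map φ (x ∷ xs)) ≡ 𝒯 (x ∷ xs)
      step x xs ih w⊆L = begin
          𝒯 (map φ w)
        ≡⟨ 𝒯-splitOn-max (∈-map⁺ φ (maxLetter-∈ x xs)) φw≤φm ⟩
          node (map 𝒯 (splitOn (φ m) (map φ w)))
        ≡⟨ cong (node ∘ map 𝒯) (splitOn-map m∈L w⊆L) ⟩
          node (map 𝒯 (map (map φ) ps))
        ≡⟨ cong node (LP.map-∘ ps) ⟨
          node (map (𝒯 ∘ map φ) ps)
        ≡⟨ cong node (LP.map-cong-local (All.zipWith (λ (e , h) → e h) (ih , All-splitOn m w⊆L))) ⟩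
          node (map 𝒯 ps)
        ≡⟨ sym (𝒯-∷ x xs) ⟩
          𝒯 w ∎
        where
        open ≡-Reasoning
        w  = x ∷ xs
        m  = maxLetter w
        ps = splitOn m w
        m∈L = All.lookup w⊆L (maxLetter-∈ x xs)
        φw≤φm : All (_≤ φ m) (map φ w)
        φw≤φm = map⁺ (All.zipWith (uncurry (λ y∈L y≤m → φ-mono-≤ y∈L m∈L y≤m)) (w⊆L , maxLetter-≥ w))

    deduplicate-map : ∀ {l} → All (_∈ L) l → deduplicate ℕ._≟_ (map φ l) ≡ map φ (deduplicate ℕ._≟_ l)
    deduplicate-map []              = refl
    deduplicate-map {x ∷ l} (x∈L ∷ h) = cong (φ x ∷_) (begin
        filter (¬? ∘ (φ x ℕ.≟_)) (deduplicate ℕ._≟_ (map φ l))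
      ≡⟨ cong (filter _) (deduplicate-map h) ⟩
        filter (¬? ∘ (φ x ℕ.≟_)) (map φ (deduplicate ℕ._≟_ l))
      ≡⟨ filter-map-local _ _ φ (All.map (λ z∈L → (λ φx≢φz x≡z → φx≢φz (cong φ x≡z)) ,
                                                     (λ x≢z φx≡φz → x≢z (φ-injective x∈L z∈L φx≡φz)))
                                         (deduplicate⁺ ℕ._≟_ h)) ⟩
        map φ (filter (¬? ∘ (x ℕ.≟_)) (deduplicate ℕ._≟_ l)) ∎)
      where open ≡-Reasoning

    count<-map : ∀ {x D} → x ∈ L → All (_∈ L) D → count< (φ x) (map φ D) ≡ count< x D
    count<-map {x} {D} x∈L D⊆L = trans
      (cong length (filter-map-local (_<? φ x) (_<? x) φ (All.map same-side D⊆L)))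
      (LP.length-map φ (filter (_<? x) D))
      where
      same-side : ∀ {z} → z ∈ L → (φ z < φ x → z < x) × (z < x → φ z < φ x)
      same-side z∈L = (λ φz<φx → ≰⇒> (λ x≤z → <⇒≱ φz<φx (φ-mono-≤ x∈L z∈L x≤z))) , φ-mono z∈L x∈L

    pack-map : ∀ {w} → All (_∈ L) w → pack (map φ w) ≡ pack w
    pack-map {w} w⊆L = begin
        map (rank (map φ w)) (map φ w)
      ≡⟨ LP.map-∘ w ⟨
        map (rank (map φ w) ∘ φ) w
      ≡⟨ LP.map-cong-local (All.map rank-φ w⊆L) ⟩
        map (rank w) w ∎
      where
      open ≡-Reasoning
      rank-φ : ∀ {x} → x ∈ L → rank (map φ w) (φ x) ≡ rank w x
      rank-φ {x} x∈L = trans (cong (count< (φ x)) (deduplicate-map w⊆L))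
                         (count<-map x∈L (deduplicate⁺ ℕ._≟_ w⊆L))

  𝒯-pack : ∀ w → 𝒯 (pack w) ≡ 𝒯 w
  𝒯-pack w = Relabel.𝒯-map w (rank w) (rank-mono w) w (All.tabulate id)

  pack-isPacked : ∀ w → IsPacked (pack w)
  pack-isPacked w = Relabel.pack-map w (rank w) (rank-mono w) (All.tabulate id)

  pack-< : ∀ w → All (_< length w) (pack w)
  pack-< w = map⁺ (All.tabulate (rank-< w))

  wordsOf-length : ∀ n k → All (λ u → length u ≡ n) (wordsOf n k)
  wordsOf-length zero    k = refl ∷ []
  wordsOf-length (suc n) k = concat⁺ (map⁺ (All.tabulate {xs = upTo k} (λ _ → map⁺ (All.map (cong suc) (wordsOf-length n k)))))

  wordsOf-∈ : ∀ {n k v} → length v ≡ n → All (_< k) v → v ∈ wordsOf n k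
  wordsOf-∈ {zero}  {v = []}    refl []           = here refl
  wordsOf-∈ {suc n} {v = y ∷ v} refl (y<k ∷ v<k) =
    ∈-concatMap⁺ (λ x → map (x ∷_) (wordsOf n _)) (Any.map (λ { refl → ∈-map⁺ (y ∷_) (wordsOf-∈ refl v<k) }) (∈-upTo⁺ y<k))

  length-cut : ∀ {i} (w : Word) → i < length w → length (take (suc i) w) + length (drop i w) ∸ 1 ≡ length w
  length-cut {i} w i<|w| = begin
      length (take (suc i) w) + length (drop i w) ∸ 1
    ≡⟨ cong₂ (λ a b → a + b ∸ 1) (trans (LP.length-take (suc i) w) (m≤n⇒m⊓n≡m i<|w|)) (LP.length-drop i w) ⟩
      i + (length w ∸ i)
    ≡⟨ m+[n∸m]≡n (<⇒≤ i<|w|) ⟩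
      length w ∎
    where open ≡-Reasoning

module FiniteSums {c ℓ : Level} (K : Field c ℓ) where

  open Field K
  open import Algebra.Properties.CommutativeSemigroup +-commutativeSemigroup using () renaming (interchange to +-interchange)
  open import Data.List using (List; []; _∷_; _++_; map; filter; concatMap)
  import Data.List.Properties as LP
  open import Data.List.Relation.Unary.All as All using (All; []; _∷_)
  open import Data.List.Relation.Unary.All.Properties using (map⁺)
  open import Data.List.Relation.Unary.Any using (here; there)
  open import Data.List.Relation.Unary.Unique.Propositional using (Unique; _∷_)
  open import Data.List.Membership.Propositional using (_∈_; _∉_)
  open import Relation.Binary.Definitions using (DecidableEquality)
  open import Relation.Binary.PropositionalEquality as ≡ using (_≡_)
  open import Relation.Nullary using (¬_; Dec; yes; no)
  open import Relation.Unary using (Pred; Decidable)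
  open import Data.Empty using (⊥-elim)
  open import Relation.Binary.Reasoning.Setoid setoid

  ∑ : List Carrier → Carrier
  ∑ = Σᴷ K

  _when_ : ∀ {p} {P : Set p} → Carrier → Dec P → Carrier
  a when yes _ = a
  a when no _  = 0#

  ∑-cong : ∀ {a} {A : Set a} {f g : A → Carrier} L → (∀ x → f x ≈ g x) → ∑ (map f L) ≈ ∑ (map g L)
  ∑-cong []      f≈g = refl
  ∑-cong (x ∷ L) f≈g = +-cong (f≈g x) (∑-cong L f≈g)

  ∑-map : ∀ {a b} {A : Set a} {B : Set b} (f : B → Carrier) (g : A → B) L → ∑ (map f (map g L)) ≡ ∑ (map (f ∘ g) L)
  ∑-map f g L = ≡.cong ∑ (≡.sym (LP.map-∘ L))

  ∑-zero : ∀ {xs} → All (_≈ 0#) xs → ∑ xs ≈ 0#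
  ∑-zero []           = refl
  ∑-zero (x≈0 ∷ xs≈0) = trans (+-cong x≈0 (∑-zero xs≈0)) (+-identityˡ 0#)

  ∑-++ : ∀ xs ys → ∑ (xs ++ ys) ≈ ∑ xs + ∑ ys
  ∑-++ []       ys = sym (+-identityˡ _)
  ∑-++ (x ∷ xs) ys = trans (+-congˡ (∑-++ xs ys)) (sym (+-assoc _ _ _))

  ∑-+ : ∀ {a} {A : Set a} (f g : A → Carrier) L → ∑ (map (λ x → f x + g x) L) ≈ ∑ (map f L) + ∑ (map g L)
  ∑-+ f g []      = sym (+-identityˡ 0#)
  ∑-+ f g (x ∷ L) = trans (+-congˡ (∑-+ f g L)) (+-interchange _ _ _ _)

  ∑-*ˡ : ∀ {a} {A : Set a} k (f : A → Carrier) L → k * ∑ (map f L) ≈ ∑ (map (λ x → k * f x) L)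
  ∑-*ˡ k f []      = zeroʳ k
  ∑-*ˡ k f (x ∷ L) = trans (distribˡ k _ _) (+-congˡ (∑-*ˡ k f L))

  ∑-*ʳ : ∀ {a} {A : Set a} k (f : A → Carrier) L → ∑ (map f L) * k ≈ ∑ (map (λ x → f x * k) L)
  ∑-*ʳ k f []      = zeroˡ k
  ∑-*ʳ k f (x ∷ L) = trans (distribʳ k _ _) (+-congˡ (∑-*ʳ k f L))

  ∑-comm : ∀ {a b} {A : Set a} {B : Set b} (f : A → B → Carrier) L M →
           ∑ (map (λ x → ∑ (map (f x) M)) L) ≈ ∑ (map (λ y → ∑ (map (λ x → f x y) L)) M)
  ∑-comm f []      M = sym (∑-zero (map⁺ (All.tabulate {xs = M} (λ _ → refl))))
  ∑-comm f (x ∷ L) M = trans (+-congˡ (∑-comm f L M)) (sym (∑-+ (f x) _ M))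

  ∑-concatMap : ∀ {a b} {A : Set a} {B : Set b} (f : B → Carrier) (g : A → List B) L →
                ∑ (map f (concatMap g L)) ≈ ∑ (map (λ x → ∑ (map f (g x))) L)
  ∑-concatMap f g []      = refl
  ∑-concatMap f g (x ∷ L) = begin
      ∑ (map f (g x ++ concatMap g L))             ≡⟨ ≡.cong ∑ (LP.map-++ f (g x) _) ⟩
      ∑ (map f (g x) ++ map f (concatMap g L))     ≈⟨ ∑-++ (map f (g x)) _ ⟩
      ∑ (map f (g x)) + ∑ (map f (concatMap g L)) ≈⟨ +-congˡ (∑-concatMap f g L) ⟩
      ∑ (map f (g x)) + ∑ (map (λ x → ∑ (map f (g x))) L) ∎

  ∑-filter : ∀ {a p} {A : Set a} {P : Pred A p} (P? : Decidable P) (f : A → Carrier) L →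
             ∑ (map f (filter P? L)) ≈ ∑ (map (λ x → f x when P? x) L)
  ∑-filter P? f []      = refl
  ∑-filter P? f (x ∷ L) with P? x
  ... | yes _ = +-congˡ (∑-filter P? f L)
  ... | no  _ = trans (∑-filter P? f L) (sym (+-identityˡ _))

  when-zero : ∀ {p} {P : Set p} (d : Dec P) {a} → a ≈ 0# → a when d ≈ 0#
  when-zero (yes _) a≈0 = a≈0
  when-zero (no _)  _   = refl

  when-absurd : ∀ {p} {P : Set p} (d : Dec P) {a} → ¬ P → a when d ≈ 0#
  when-absurd (yes p) ¬p = ⊥-elim (¬p p)
  when-absurd (no _)  _  = refl

  when-⇔ : ∀ {p q} {P : Set p} {Q : Set q} (d : Dec P) (e : Dec Q) {a} → (P → Q) → (Q → P) → a when d ≈ a when e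
  when-⇔ (yes _)  (yes _)  _ _ = refl
  when-⇔ (no _)   (no _)   _ _ = refl
  when-⇔ (yes p)  (no ¬q)  f _ = ⊥-elim (¬q (f p))
  when-⇔ (no ¬p)  (yes q)  _ g = ⊥-elim (¬p (g q))

  *-1-when : ∀ {p} {P : Set p} (d : Dec P) a → a * (1# when d) ≈ a when d
  *-1-when (yes _) a = *-identityʳ a
  *-1-when (no _)  a = zeroʳ a

  module _ {a} {A : Set a} (_≟_ : DecidableEquality A) where

    ∑-when-≟-∉ : ∀ {y} (h : A → Carrier) {L} → y ∉ L → ∑ (map (λ x → h x when (y ≟ x)) L) ≈ 0#
    ∑-when-≟-∉ {y} h y∉L = ∑-zero (map⁺ (All.tabulate (λ {x} x∈L → when-absurd (y ≟ x) (λ { ≡.refl → y∉L x∈L }))))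

    ∑-when-≟-∈ : ∀ {y} (h : A → Carrier) {L} → Unique L → y ∈ L → ∑ (map (λ x → h x when (y ≟ x)) L) ≈ h y
    ∑-when-≟-∈ {y} h {x ∷ L} (x∉L ∷ L!) y∈ with y ≟ x
    ... | yes ≡.refl = trans (+-congˡ (∑-when-≟-∉ h (λ y∈L → All.lookup x∉L y∈L ≡.refl))) (+-identityʳ _)
    ... | no y≢x with y∈
    ...   | here y≡x  = ⊥-elim (y≢x y≡x)
    ...   | there y∈L = trans (+-identityˡ _) (∑-when-≟-∈ h L! y∈L)

module Span {c ℓ : Level} (K : Field c ℓ) where

  open Field K
  open Trees
  open FiniteSums K
  open import Algebra.Properties.CommutativeSemigroup *-commutativeSemigroup using () renaming (x∙yz≈y∙xz to *-x∙yz≈y∙xz)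
  open import Data.Nat as ℕ using (ℕ; zero; suc; _∸_; _<_)
  open import Data.List using (List; []; _∷_; _++_; map; length; filter; concatMap; deduplicate; upTo; applyUpTo; take; drop)
  import Data.List.Properties as LP
  open import Data.List.NonEmpty as L⁺ using (List⁺; _∷_; toList)
  open import Data.List.Relation.Unary.All as All using (All; []; _∷_)
  open import Data.List.Relation.Unary.All.Properties using (++⁺; map⁺; applyUpTo⁺₁)
  open import Data.List.Relation.Unary.Unique.Propositional.Properties using (upTo⁺)
  open import Data.List.Relation.Unary.Unique.DecPropositional.Properties _≟ᵀ_ using (deduplicate-!)
  open import Data.List.Membership.Propositional using (_∈_)
  open import Data.List.Membership.Propositional.Properties
    using (∈-upTo⁺; ∈-map⁺; ∈-map⁻; ∈-filter⁺; ∈-filter⁻; ∈-deduplicate⁺; ∈-deduplicate⁻)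
  open import Data.List.Membership.DecPropositional _≟ᵀ_ using (_∈?_)
  open import Data.Product using (_×_)
  open import Relation.Binary.Definitions using (DecidableEquality)
  open import Relation.Binary.PropositionalEquality as ≡ using (_≡_; _≢_)
  open import Relation.Nullary using (yes; no)
  open import Data.Empty using (⊥; ⊥-elim)
  open import Relation.Binary.Reasoning.Setoid setoid

  _≟ʷ_ : DecidableEquality Word
  _≟ʷ_ = LP.≡-dec ℕ._≟_

  ∑-wordsOf-when-≟ʷ : ∀ n k {v} (a : Word → Carrier) → length v ≡ n → All (_< k) v →
                      ∑ (map (λ u → a u when (v ≟ʷ u)) (wordsOf n k)) ≈ a v
  ∑-wordsOf-when-≟ʷ zero    k {[]}    a ≡.refl []            = +-identityʳ (a [])
  ∑-wordsOf-when-≟ʷ (suc n) k {y ∷ v} a ≡.refl (y<k ∷ v<k) = begin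
      ∑ (map F (concatMap (λ x → map (x ∷_) (wordsOf n k)) (upTo k)))
    ≈⟨ ∑-concatMap F _ (upTo k) ⟩
      ∑ (map (λ x → ∑ (map F (map (x ∷_) (wordsOf n k)))) (upTo k))
    ≈⟨ ∑-cong (upTo k) column ⟩
      ∑ (map (λ x → a (y ∷ v) when (y ℕ.≟ x)) (upTo k))
    ≈⟨ ∑-when-≟-∈ ℕ._≟_ (λ _ → a (y ∷ v)) (upTo⁺ k) (∈-upTo⁺ y<k) ⟩
      a (y ∷ v) ∎
    where
    F : Word → Carrier
    F u = a u when ((y ∷ v) ≟ʷ u)
    column : ∀ x → ∑ (map F (map (x ∷_) (wordsOf n k))) ≈ a (y ∷ v) when (y ℕ.≟ x)
    column x with y ℕ.≟ x
    ... | yes ≡.refl = begin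
        ∑ (map F (map (y ∷_) (wordsOf n k)))
      ≡⟨ ∑-map F (y ∷_) (wordsOf n k) ⟩
        ∑ (map (F ∘ (y ∷_)) (wordsOf n k))
      ≈⟨ ∑-cong (wordsOf n k) (λ u → when-⇔ ((y ∷ v) ≟ʷ (y ∷ u)) (v ≟ʷ u) LP.∷-injectiveʳ (≡.cong (y ∷_))) ⟩
        ∑ (map (λ u → a (y ∷ u) when (v ≟ʷ u)) (wordsOf n k))
      ≈⟨ ∑-wordsOf-when-≟ʷ n k (a ∘ (y ∷_)) ≡.refl v<k ⟩
        a (y ∷ v) ∎
    ... | no y≢x = trans (reflexive (∑-map F (x ∷_) (wordsOf n k)))
                         (∑-zero (map⁺ (All.tabulate {xs = wordsOf n k} λ {u} _ → when-absurd ((y ∷ v) ≟ʷ (x ∷ u)) (y≢x ∘ LP.∷-injectiveˡ))))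

  𝐌-apply : ∀ u w → 𝐌 K u w ≡ 1# when (pack (toList w) ≟ʷ u)
  𝐌-apply u w with pack (toList w) ≟ʷ u
  ... | yes _ = ≡.refl
  ... | no _  = ≡.refl

  δ : Tree → Tree → Carrier
  δ s t = 1# when (s ≟ᵀ t)

  ℳ-apply : ∀ R w → ℳ K R w ≈ δ (𝒯 (toList w)) R
  ℳ-apply R w@(x ∷ xs) = begin
      ℳ K R w
    ≈⟨ ∑-filter (λ u → 𝒯 u ≟ᵀ R) (λ u → 𝐌 K u w) (packedWordsOfLength n) ⟩
      ∑ (map (λ u → 𝐌 K u w when (𝒯 u ≟ᵀ R)) (filter isPacked? (wordsOf n n)))
    ≈⟨ ∑-filter isPacked? _ (wordsOf n n) ⟩
      ∑ (map (λ u → (𝐌 K u w when (𝒯 u ≟ᵀ R)) when isPacked? u) (wordsOf n n))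
    ≈⟨ ∑-cong (wordsOf n n) summand ⟩
      ∑ (map (λ u → δ (𝒯 u) R when (pack W ≟ʷ u)) (wordsOf n n))
    ≈⟨ ∑-wordsOf-when-≟ʷ n n (λ u → δ (𝒯 u) R) (LP.length-map _ W) (pack-< W) ⟩
      δ (𝒯 (pack W)) R
    ≡⟨ ≡.cong (λ t → δ t R) (𝒯-pack W) ⟩
      δ (𝒯 W) R ∎
    where
    W = toList w
    n = L⁺.length w
    summand : ∀ u → (𝐌 K u w when (𝒯 u ≟ᵀ R)) when isPacked? u ≈ δ (𝒯 u) R when (pack W ≟ʷ u)
    summand u rewrite 𝐌-apply u w with pack W ≟ʷ u
    ... | no _ = when-zero (isPacked? u) (when-zero (𝒯 u ≟ᵀ R) refl)
    ... | yes ≡.refl with isPacked? (pack W)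
    ...   | yes _        = refl
    ...   | no unpacked  = ⊥-elim (unpacked (pack-isPacked W))

  LinComb : ∀ {a} {A : Set a} → List A → (A → Carrier) → (A → Series K) → Series K
  LinComb L coef F w = ∑ (map (λ x → coef x * F x w) L)

  InTD-resp-≋ : ∀ {f g} → _≋_ K f g → InTD K g → InTD K f
  InTD-resp-≋ f≋g (cs , wordTrees , g≋) = cs , wordTrees , λ w → trans (f≋g w) (g≋ w)

  lincomb-++ : ∀ cs ds w → lincomb K (cs ++ ds) w ≈ lincomb K cs w + lincomb K ds w
  lincomb-++ cs ds w = trans (reflexive (≡.cong ∑ (LP.map-++ term cs ds))) (∑-++ (map term cs) (map term ds))
    where
    term : Carrier × Tree → Carrier
    term cT = proj₁ cT * ℳ K (proj₂ cT) w

  lincomb-scale : ∀ k cs w → k * lincomb K cs w ≈ lincomb K (map (λ cT → k * proj₁ cT , proj₂ cT) cs) w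
  lincomb-scale k cs w = begin
      k * lincomb K cs w
    ≈⟨ ∑-*ˡ k _ cs ⟩
      ∑ (map (λ cT → k * (proj₁ cT * ℳ K (proj₂ cT) w)) cs)
    ≈⟨ ∑-cong cs (λ cT → sym (*-assoc k _ _)) ⟩
      ∑ (map (λ cT → (k * proj₁ cT) * ℳ K (proj₂ cT) w) cs)
    ≡⟨ ∑-map _ _ cs ⟨
      lincomb K (map (λ cT → k * proj₁ cT , proj₂ cT) cs) w ∎

  InTD-LinComb : ∀ {a} {A : Set a} (L : List A) coef (F : A → Series K) → (∀ x → InTD K (F x)) → InTD K (LinComb L coef F)
  InTD-LinComb []      coef F F∈ = [] , [] , λ w → refl
  InTD-LinComb (x ∷ L) coef F F∈ with F∈ x | InTD-LinComb L coef F F∈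
  ... | cs , cs-trees , Fx≋ | ds , ds-trees , rest≋ =
    xcs ++ ds ,
    ++⁺ (map⁺ cs-trees) ds-trees ,
    λ w → begin
      coef x * F x w + LinComb L coef F w
    ≈⟨ +-cong (*-congˡ (Fx≋ w)) (rest≋ w) ⟩
      coef x * lincomb K cs w + lincomb K ds w
    ≈⟨ +-congʳ (lincomb-scale (coef x) cs w) ⟩
      lincomb K (map (λ cT → coef x * proj₁ cT , proj₂ cT) cs) w + lincomb K ds w
    ≈⟨ lincomb-++ xcs ds w ⟨
      lincomb K (xcs ++ ds) w ∎
    where
    xcs = map (λ cT → coef x * proj₁ cT , proj₂ cT) cs

  #-cong : ∀ {f f′ g g′} → _≋_ K f f′ → _≋_ K g g′ → _≋_ K (_#_ K f g) (_#_ K f′ g′)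
  #-cong f≋ g≋ (x ∷ xs) = ∑-cong (splits K x xs) (λ ps → *-cong (f≋ (proj₁ ps)) (g≋ (proj₂ ps)))

  LinComb-#ˡ : ∀ {a} {A : Set a} (L : List A) coef (F : A → Series K) g →
               _≋_ K (_#_ K (LinComb L coef F) g) (LinComb L coef (λ x → _#_ K (F x) g))
  LinComb-#ˡ L coef F g (x ∷ xs) = begin
      ∑ (map (λ ps → LinComb L coef F (proj₁ ps) * g (proj₂ ps)) Ps)
    ≈⟨ ∑-cong Ps (λ ps → trans (∑-*ʳ _ _ L) (∑-cong L (λ y → *-assoc (coef y) _ _))) ⟩
      ∑ (map (λ ps → ∑ (map (λ y → coef y * (F y (proj₁ ps) * g (proj₂ ps))) L)) Ps)
    ≈⟨ ∑-comm (λ ps y → coef y * (F y (proj₁ ps) * g (proj₂ ps))) Ps L ⟩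
      ∑ (map (λ y → ∑ (map (λ ps → coef y * (F y (proj₁ ps) * g (proj₂ ps))) Ps)) L)
    ≈⟨ ∑-cong L (λ y → sym (∑-*ˡ (coef y) _ Ps)) ⟩
      LinComb L coef (λ y → _#_ K (F y) g) (x ∷ xs) ∎
    where Ps = splits K x xs

  LinComb-#ʳ : ∀ {a} {A : Set a} (L : List A) coef f (G : A → Series K) →
               _≋_ K (_#_ K f (LinComb L coef G)) (LinComb L coef (λ x → _#_ K f (G x)))
  LinComb-#ʳ L coef f G (x ∷ xs) = begin
      ∑ (map (λ ps → f (proj₁ ps) * LinComb L coef G (proj₂ ps)) Ps)
    ≈⟨ ∑-cong Ps (λ ps → trans (∑-*ˡ _ _ L) (∑-cong L (λ y → *-x∙yz≈y∙xz _ (coef y) _))) ⟩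
      ∑ (map (λ ps → ∑ (map (λ y → coef y * (f (proj₁ ps) * G y (proj₂ ps))) L)) Ps)
    ≈⟨ ∑-comm (λ ps y → coef y * (f (proj₁ ps) * G y (proj₂ ps))) Ps L ⟩
      ∑ (map (λ y → ∑ (map (λ ps → coef y * (f (proj₁ ps) * G y (proj₂ ps))) Ps)) L)
    ≈⟨ ∑-cong L (λ y → sym (∑-*ˡ (coef y) _ Ps)) ⟩
      LinComb L coef (λ y → _#_ K f (G y)) (x ∷ xs) ∎
    where Ps = splits K x xs

  InTD-treeFunction : (φ : Tree → Carrier) (N : ℕ) →
                      (∀ w → length (toList w) ≢ N → φ (𝒯 (toList w)) ≈ 0#) →
                      InTD K (λ w → φ (𝒯 (toList w)))
  InTD-treeFunction φ zero    vanish = [] , [] , λ w@(_ ∷ _) → vanish w (λ ())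
  InTD-treeFunction φ (suc M) vanish = map (λ R → φ R , R) Rs , map⁺ (All.tabulate word-tree) , eval
    where
    Rs : List Tree
    Rs = deduplicate _≟ᵀ_ (map 𝒯 (packedWordsOfLength (suc M)))

    word-tree : ∀ {R} → R ∈ Rs → IsWordTree K R
    word-tree R∈Rs with ∈-map⁻ 𝒯 (∈-deduplicate⁻ _≟ᵀ_ _ R∈Rs)
    ... | u , u∈ , R≡𝒯u with u | All.lookup (wordsOf-length (suc M) (suc M)) (proj₁ (∈-filter⁻ isPacked? u∈))
    ...   | a ∷ as | _ = (a ∷ as) , ≡.sym R≡𝒯u

    member : ∀ W → length W ≡ suc M → 𝒯 W ∈ Rs
    member W |W|≡N = ∈-deduplicate⁺ _≟ᵀ_ (≡.subst (_∈ map 𝒯 _) (𝒯-pack W)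
      (∈-map⁺ 𝒯 (∈-filter⁺ isPacked?
        (wordsOf-∈ (≡.trans (LP.length-map _ W) |W|≡N) (≡.subst (λ n → All (_< n) (pack W)) |W|≡N (pack-< W)))
        (pack-isPacked W))))

    eval : ∀ w → φ (𝒯 (toList w)) ≈ lincomb K (map (λ R → φ R , R) Rs) w
    eval w = sym (begin
        lincomb K (map (λ R → φ R , R) Rs) w
      ≡⟨ ∑-map _ _ Rs ⟩
        ∑ (map (λ R → φ R * ℳ K R w) Rs)
      ≈⟨ ∑-cong Rs (λ R → trans (*-congˡ (ℳ-apply R w)) (*-1-when (W ≟ᵀ R) (φ R))) ⟩
        ∑ (map (λ R → φ R when (W ≟ᵀ R)) Rs)
      ≈⟨ δ-sum ⟩
        φ W ∎)
      where
      W = 𝒯 (toList w)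
      δ-sum : ∑ (map (λ R → φ R when (W ≟ᵀ R)) Rs) ≈ φ W
      δ-sum with W ∈? Rs
      ... | yes W∈Rs = ∑-when-≟-∈ _≟ᵀ_ φ (deduplicate-! _) W∈Rs
      ... | no W∉Rs  = trans (∑-when-≟-∉ _≟ᵀ_ φ W∉Rs)
                             (sym (vanish w (λ |w|≡N → W∉Rs (member (toList w) |w|≡N))))

  toWords : List⁺ ℕ × List⁺ ℕ → Word × Word
  toWords ps = toList (proj₁ ps) , toList (proj₂ ps)

  -- The i-th pair (p , s) with p # s = w: the factors share the letter at position i.
  cut : Word → ℕ → Word × Word
  cut w i = take (suc i) w , drop i w

  splits-cuts : ∀ x xs → map toWords (splits K x xs) ≡
                         applyUpTo (cut (x ∷ xs)) (suc (length xs))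
  splits-cuts x []       = ≡.refl
  splits-cuts x (y ∷ ys) = ≡.cong ((x ∷ [] , x ∷ y ∷ ys) ∷_)
    (≡.trans extend-commutes (≡.trans (≡.cong (map extend) (splits-cuts y ys)) (LP.map-applyUpTo (cut (y ∷ ys)) extend _)))
    where
    extend : Word × Word → Word × Word
    extend ps = x ∷ proj₁ ps , proj₂ ps
    extend-commutes : map toWords (map (λ ps → x L⁺.∷⁺ proj₁ ps , proj₂ ps) (splits K y ys)) ≡
                      map extend (map toWords (splits K y ys))
    extend-commutes = ≡.trans (≡.sym (LP.map-∘ (splits K y ys))) (LP.map-∘ (splits K y ys))

  applyUpTo-cong : ∀ {a} {A : Set a} {f g : ℕ → A} → (∀ i → f i ≡ g i) → ∀ n → applyUpTo f n ≡ applyUpTo g n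
  applyUpTo-cong f≡g zero    = ≡.refl
  applyUpTo-cong f≡g (suc n) = ≡.cong₂ _∷_ (f≡g 0) (applyUpTo-cong (f≡g ∘ suc) n)

  cutWeight : Tree → Tree → Word × Word → Carrier
  cutWeight S T ps = δ (𝒯 (proj₁ ps)) S * δ (𝒯 (proj₂ ps)) T

  cutCount : Tree → Tree → Word → Carrier
  cutCount S T w = ∑ (applyUpTo (cutWeight S T ∘ cut w) (length w))

  cutCountᵀ : Tree → Tree → Tree → Carrier
  cutCountᵀ S T R = ∑ (applyUpTo (λ i → δ (prefixTree (suc i) R) S * δ (suffixTree i R) T) (size R))

  ℳ-#-ℳ-apply : ∀ S T x xs → _#_ K (ℳ K S) (ℳ K T) (x ∷ xs) ≈ cutCount S T (x ∷ xs)
  ℳ-#-ℳ-apply S T x xs = begin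
      ∑ (map (λ ps → ℳ K S (proj₁ ps) * ℳ K T (proj₂ ps)) (splits K x xs))
    ≈⟨ ∑-cong (splits K x xs) (λ ps → *-cong (ℳ-apply S (proj₁ ps)) (ℳ-apply T (proj₂ ps))) ⟩
      ∑ (map (cutWeight S T ∘ toWords) (splits K x xs))
    ≡⟨ ∑-map (cutWeight S T) toWords (splits K x xs) ⟨
      ∑ (map (cutWeight S T) (map toWords (splits K x xs)))
    ≡⟨ ≡.cong (∑ ∘ map (cutWeight S T)) (splits-cuts x xs) ⟩
      ∑ (map (cutWeight S T) (applyUpTo (cut (x ∷ xs)) (suc (length xs))))
    ≡⟨ ≡.cong ∑ (LP.map-applyUpTo (cut (x ∷ xs)) (cutWeight S T) (suc (length xs))) ⟩
      cutCount S T (x ∷ xs) ∎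

  cutCount-𝒯 : ∀ S T w → cutCount S T w ≡ cutCountᵀ S T (𝒯 w)
  cutCount-𝒯 S T w = ≡.trans
    (≡.cong (λ n → ∑ (applyUpTo (cutWeight S T ∘ cut w) n)) (≡.sym (size-𝒯 w)))
    (≡.cong ∑ (applyUpTo-cong (λ i → ≡.cong₂ (λ p s → δ p S * δ s T) (𝒯-take w (suc i)) (𝒯-drop w i)) (size (𝒯 w))))

  cutWeight-zero : ∀ S T ps → (𝒯 (proj₁ ps) ≡ S → 𝒯 (proj₂ ps) ≡ T → ⊥) → cutWeight S T ps ≈ 0#
  cutWeight-zero S T (p , s) ¬both with 𝒯 p ≟ᵀ S | 𝒯 s ≟ᵀ T
  ... | yes 𝒯p≡S | yes 𝒯s≡T = ⊥-elim (¬both 𝒯p≡S 𝒯s≡T)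
  ... | yes _    | no _     = zeroʳ 1#
  ... | no _     | _        = zeroˡ _

  cutCount-vanishes : ∀ S T w → length w ≢ size S ℕ.+ size T ∸ 1 → cutCount S T w ≈ 0#
  cutCount-vanishes S T w |w|≢N = ∑-zero (applyUpTo⁺₁ _ (length w) λ {i} i<|w| →
    cutWeight-zero S T (cut w i) λ { ≡.refl ≡.refl → |w|≢N (≡.sym (size-of-cut i<|w|)) })
    where
    size-of-cut : ∀ {i} → i < length w → size (𝒯 (take (suc i) w)) ℕ.+ size (𝒯 (drop i w)) ∸ 1 ≡ length w
    size-of-cut {i} i<|w| =
      ≡.trans (≡.cong₂ (λ a b → a ℕ.+ b ∸ 1) (size-𝒯 (take (suc i) w)) (size-𝒯 (drop i w))) (length-cut w i<|w|)

  InTD-ℳ-#-ℳ : ∀ S T → InTD K (_#_ K (ℳ K S) (ℳ K T))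
  InTD-ℳ-#-ℳ S T = InTD-resp-≋ coefficient
    (InTD-treeFunction (cutCountᵀ S T) (size S ℕ.+ size T ∸ 1)
      (λ w |w|≢N → trans (reflexive (≡.sym (cutCount-𝒯 S T (toList w)))) (cutCount-vanishes S T (toList w) |w|≢N)))
    where
    coefficient : _≋_ K (_#_ K (ℳ K S) (ℳ K T)) (λ w → cutCountᵀ S T (𝒯 (toList w)))
    coefficient (x ∷ xs) = trans (ℳ-#-ℳ-apply S T x xs) (reflexive (cutCount-𝒯 S T (x ∷ xs)))

corollary5p7 : ∀ {c ℓ : Level} (K : Field c ℓ) (f g : Series K) →
                 InTD K f → InTD K g → InTD K (_#_ K f g)
corollary5p7 K f g (cs , _ , f≋) (ds , _ , g≋) =
  InTD-resp-≋ (#-cong f≋ g≋) (InTD-resp-≋ (LinComb-#ˡ cs proj₁ (ℳ K ∘ proj₂) (lincomb K ds))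
    (InTD-LinComb cs proj₁ _ λ (_ , S) →
      InTD-resp-≋ (LinComb-#ʳ ds proj₁ (ℳ K S) (ℳ K ∘ proj₂))
        (InTD-LinComb ds proj₁ _ λ (_ , T) → InTD-ℳ-#-ℳ S T)))
  where open Span K
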